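{- Every nonempty gap of a biflag $\mathscr F|\mathscr G$ of $\mathrm{M}$ has at least two distinct elements.
   Context: $\mathrm M$ is a loopless and coloopless matroid on $E$ with dual $\mathrm M^\perp$. A biflat is $F|G$ with $F$ a flat of $\mathrm M$, $G$ a flat of $\mathrm M^\perp$, both nonempty, not both $E$, $F\cup G=E$; a biflag (flag of biflats) of length $k$ is a set of pairwise comparable biflats (i.e. $F\subseteq F'$ and $G\supseteq G'$, or the reverse) whose sets $F\cap G$ do not cover $E$; write it as $F_1|G_1,\dots,F_k|G_k$ with $F_1\subseteq\cdots\subseteq F_k$ and $G_1\supseteq\cdots\supseteq G_k$, and set $F_0=\varnothing$, $G_0=E$, $F_{k+1}=E$, $G_{k+1}=\varnothing$. The gaps of $\mathscr F|\mathscr G$ are $D_j=(F_{j+1}-F_j)\cap(G_j-G_{j+1})$ for $0\le j\le k$. -}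

module Defs where

open import Data.Nat using (ℕ; zero; suc; _+_; _∸_; _≤_; _<_; _<?_)
open import Data.Fin using (Fin; toℕ; fromℕ<)
open import Data.Fin.Subset using (Subset; ⊥; ⊤; ⁅_⁆; _∈_; _∉_; _⊆_; _∩_; _∪_; _─_; ∁; ∣_∣; Nonempty)
open import Data.Product using (_×_; ∃)
open import Relation.Nullary using (¬_; yes; no)
open import Relation.Binary.PropositionalEquality using (_≡_; _≢_)

record Matroid (n : ℕ) : Set where
  field
    rank          : Subset n → ℕ
    rank-bounded  : ∀ A → rank A ≤ ∣ A ∣
    rank-mono     : ∀ {A B} → A ⊆ B → rank A ≤ rank B
    rank-submod   : ∀ A B → rank (A ∪ B) + rank (A ∩ B) ≤ rank A + rank B

open Matroid public

dualRank : ∀ {n} → Matroid n → Subset n → ℕ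
dualRank M A = ∣ A ∣ + rank M (∁ A) ∸ rank M ⊤

IsFlatWrt : ∀ {n} → (Subset n → ℕ) → Subset n → Set
IsFlatWrt r F = ∀ e → e ∉ F → r F < r (F ∪ ⁅ e ⁆)

IsFlat : ∀ {n} → Matroid n → Subset n → Set
IsFlat M = IsFlatWrt (rank M)

IsDualFlat : ∀ {n} → Matroid n → Subset n → Set
IsDualFlat M = IsFlatWrt (dualRank M)

-- e is a loop iff r{e} = 0; e is a coloop iff r(E − e) < r(E).
Loopless : ∀ {n} → Matroid n → Set
Loopless M = ∀ e → rank M ⁅ e ⁆ ≡ 1

Coloopless : ∀ {n} → Matroid n → Set
Coloopless M = ∀ e → rank M (∁ ⁅ e ⁆) ≡ rank M ⊤

IsBiflat : ∀ {n} → Matroid n → Subset n → Subset n → Set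
IsBiflat M F G =
  IsFlat M F × IsDualFlat M G × Nonempty F × Nonempty G
  × ¬ (F ≡ ⊤ × G ≡ ⊤) × (F ∪ G ≡ ⊤)

-- A biflag of length k, written in increasing order:
-- F i ⊆ F j and G i ⊇ G j for i < j, entries pairwise distinct
-- (it is a set of biflats), and the sets F i ∩ G i do not cover E.
record IsBiflag {n} (M : Matroid n) (k : ℕ) (F G : Fin k → Subset n) : Set where
  field
    biflat   : ∀ i → IsBiflat M (F i) (G i)
    F-mono   : ∀ i j → toℕ i < toℕ j → F i ⊆ F j
    G-anti   : ∀ i j → toℕ i < toℕ j → G j ⊆ G i
    distinct : ∀ i j → toℕ i < toℕ j → ¬ (F i ≡ F j × G i ≡ G j)
    nonCover : ∃ λ e → ∀ i → e ∉ (F i ∩ G i)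

ext : ∀ {n k} → (Fin k → Subset n) → Subset n → Subset n → ℕ → Subset n
ext s first last zero = first
ext {k = k} s first last (suc i) with i <? k
... | yes p = s (fromℕ< p)
... | no _  = last

-- F_0 = ∅, F_{k+1} = E ;  G_0 = E, G_{k+1} = ∅.
Fext : ∀ {n k} → (Fin k → Subset n) → ℕ → Subset n
Fext F = ext F ⊥ ⊤

Gext : ∀ {n k} → (Fin k → Subset n) → ℕ → Subset n
Gext G = ext G ⊤ ⊥

gap : ∀ {n k} → (Fin k → Subset n) → (Fin k → Subset n) → Fin (suc k) → Subset n
gap F G j = (Fext F (suc (toℕ j)) ─ Fext F (toℕ j)) ∩ (Gext G (toℕ j) ─ Gext G (suc (toℕ j)))

-- Suppose a gap D_j = (F_{j+1} − F_j) ∩ (G_j − G_{j+1}) were a single element e, and put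
-- A = E − G_{j+1}. Since G_{j+1} is a flat of M^⊥, A is a union of circuits of M, so
-- r(A − e) = r(A). Every element of A − e lies in F_j (otherwise it would lie in D_j), so
-- r(A) ≤ r(F_j ∩ A), and submodularity gives r(F_j ∪ A) ≤ r(F_j). As e ∈ A, the flat F_j
-- would not grow in rank when e is added. Looplessness and colooplessness make the end
-- terms F_0 = ∅ and G_{k+1} = ∅ behave like the genuine biflats.
module Submission where

open import Defs
open import Data.Nat using (ℕ; suc)
open import Data.Fin using (Fin)
open import Data.Fin.Subset using (Subset; _∈_; Nonempty)
open import Data.Product using (∃₂; _×_)
open import Relation.Binary.PropositionalEquality using (_≢_)

open import Data.Nat using (zero; _+_; _∸_; _≤_; _<_; z≤n; s≤s; s≤s⁻¹; _<?_)
open import Data.Nat.Properties hiding (_≟_)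
open import Data.Fin using (toℕ; fromℕ<; _≟_)
open import Data.Fin.Subset
open import Data.Fin.Subset.Properties
open import Data.Vec using ([]; _∷_; here; there)
open import Data.Sum using (_⊎_; inj₁; inj₂)
open import Data.Product using (∃; _,_; proj₁; proj₂)
open import Data.Empty using (⊥-elim)
open import Relation.Nullary using (¬_; yes; no; contradiction)
open import Relation.Binary.PropositionalEquality using (_≡_; refl; sym; subst; cong)

private
  variable
    n : ℕ

m∸o<n∸o⇒m<n : ∀ {a b} c → a ∸ c < b ∸ c → a < b
m∸o<n∸o⇒m<n {a} {b} c lt with a <? b
... | yes a<b = a<b
... | no a≮b = contradiction (∸-monoˡ-≤ c (≮⇒≥ a≮b)) (<⇒≱ lt)

∣p∪q∣≤∣p∣+∣q∣ : ∀ (p q : Subset n) → ∣ p ∪ q ∣ ≤ ∣ p ∣ + ∣ q ∣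
∣p∪q∣≤∣p∣+∣q∣ []            []            = z≤n
∣p∪q∣≤∣p∣+∣q∣ (inside ∷ p)  (y ∷ q)       =
  s≤s (≤-trans (∣p∪q∣≤∣p∣+∣q∣ p q) (+-monoʳ-≤ ∣ p ∣ (∣p∣≤∣x∷p∣ y q)))
∣p∪q∣≤∣p∣+∣q∣ (outside ∷ p) (inside ∷ q)  =
  subst (suc ∣ p ∪ q ∣ ≤_) (sym (+-suc ∣ p ∣ ∣ q ∣)) (s≤s (∣p∪q∣≤∣p∣+∣q∣ p q))
∣p∪q∣≤∣p∣+∣q∣ (outside ∷ p) (outside ∷ q) = ∣p∪q∣≤∣p∣+∣q∣ p q

x∈p─q⇒x∉q : ∀ (p q : Subset n) {x} → x ∈ p ─ q → x ∉ q
x∈p─q⇒x∉q (_ ∷ p) (_ ∷ q) (there x∈p─q) (there x∈q) = x∈p─q⇒x∉q p q x∈p─q x∈q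
x∈p─q⇒x∉q (_ ∷ p) (inside ∷ q) () here

∪≡⊤⇒∈⊎∈ : ∀ {p q : Subset n} → p ∪ q ≡ ⊤ → ∀ x → x ∈ p ⊎ x ∈ q
∪≡⊤⇒∈⊎∈ {p = p} {q} p∪q≡⊤ x = x∈p∪q⁻ p q (subst (x ∈_) (sym p∪q≡⊤) ∈⊤)

⊆⁅x⁆⊎∃≢x : ∀ {x} (p : Subset n) → x ∈ p → p ⊆ ⁅ x ⁆ ⊎ ∃ λ y → y ≢ x × y ∈ p
⊆⁅x⁆⊎∃≢x {x = x} p x∈p with nonempty? (p - x)
... | yes (y , y∈p-x) =
  inj₂ (y , x∉⁅y⁆⇒x≢y (x∈p─q⇒x∉q p ⁅ x ⁆ y∈p-x) , p─q⊆p p _ y∈p-x)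
... | no ¬p-x = inj₁ p⊆⁅x⁆
  where
  p⊆⁅x⁆ : p ⊆ ⁅ x ⁆
  p⊆⁅x⁆ {y} y∈p with y ≟ x
  ... | yes refl = x∈⁅x⁆ x
  ... | no y≢x  = contradiction (y , x∈p∧x≢y⇒x∈p-y y∈p y≢x) ¬p-x

-- A cyclic set (a union of circuits): no element of A is a coloop of M restricted to A.
IsCyclic : Matroid n → Subset n → Set
IsCyclic M A = ∀ e → e ∈ A → rank M A ≤ rank M (A - e)

rank∩≥⇒rank∪≤ : ∀ (M : Matroid n) {F A} → rank M A ≤ rank M (F ∩ A) → rank M (F ∪ A) ≤ rank M F
rank∩≥⇒rank∪≤ M {F} {A} rA≤rF∩A = +-cancelʳ-≤ (rank M A) _ _ (begin
  rank M (F ∪ A) + rank M A        ≤⟨ +-monoʳ-≤ (rank M (F ∪ A)) rA≤rF∩A ⟩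
  rank M (F ∪ A) + rank M (F ∩ A)  ≤⟨ rank-submod M F A ⟩
  rank M F + rank M A              ∎)
  where open ≤-Reasoning

dualFlat⇒cyclic-∁ : ∀ (M : Matroid n) {G} → IsDualFlat M G → IsCyclic M (∁ G)
dualFlat⇒cyclic-∁ M {G} dualFlat e e∈∁G =
  ≤-trans (s≤s⁻¹ (+-cancelˡ-< ∣ G ∣ _ _ grows)) (rank-mono M ∁[G∪e]⊆∁G-e)
  where
  open ≤-Reasoning
  r′ = rank M (∁ (G ∪ ⁅ e ⁆))

  grows : ∣ G ∣ + rank M (∁ G) < ∣ G ∣ + suc r′
  grows = begin-strict
    ∣ G ∣ + rank M (∁ G)        <⟨ m∸o<n∸o⇒m<n (rank M ⊤) (dualFlat e (x∈∁p⇒x∉p e∈∁G)) ⟩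
    ∣ G ∪ ⁅ e ⁆ ∣ + r′          ≤⟨ +-monoˡ-≤ r′ (∣p∪q∣≤∣p∣+∣q∣ G ⁅ e ⁆) ⟩
    ∣ G ∣ + ∣ ⁅ e ⁆ ∣ + r′      ≡⟨ cong (λ c → ∣ G ∣ + c + r′) (∣⁅x⁆∣≡1 e) ⟩
    ∣ G ∣ + 1 + r′              ≡⟨ +-assoc ∣ G ∣ 1 r′ ⟩
    ∣ G ∣ + suc r′              ∎

  ∁[G∪e]⊆∁G-e : ∁ (G ∪ ⁅ e ⁆) ⊆ ∁ G - e
  ∁[G∪e]⊆∁G-e x∈ = x∈p∧x∉q⇒x∈p─q
    (x∉p⇒x∈∁p λ x∈G → x∈∁p⇒x∉p x∈ (p⊆p∪q ⁅ e ⁆ x∈G))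
    (λ x∈⁅e⁆ → x∈∁p⇒x∉p x∈ (q⊆p∪q G ⁅ e ⁆ x∈⁅e⁆))

flat-⊤ : ∀ (r : Subset n → ℕ) → IsFlatWrt r ⊤
flat-⊤ r e e∉⊤ = contradiction ∈⊤ e∉⊤

loopless⇒flat-⊥ : ∀ (M : Matroid n) → Loopless M → IsFlat M ⊥
loopless⇒flat-⊥ {n} M loopless e _ = begin-strict
  rank M ⊥                ≤⟨ rank-bounded M ⊥ ⟩
  ∣ ⊥ {n} ∣               ≡⟨ ∣⊥∣≡0 n ⟩
  0                       <⟨ s≤s z≤n ⟩
  1                       ≡⟨ sym (loopless e) ⟩
  rank M ⁅ e ⁆            ≤⟨ rank-mono M (q⊆p∪q ⊥ ⁅ e ⁆) ⟩
  rank M (⊥ ∪ ⁅ e ⁆)      ∎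
  where open ≤-Reasoning

cyclic-∁⊤ : ∀ (M : Matroid n) → IsCyclic M (∁ ⊤)
cyclic-∁⊤ M e e∈∁⊤ = contradiction ∈⊤ (x∈∁p⇒x∉p e∈∁⊤)

coloopless⇒cyclic-∁⊥ : ∀ (M : Matroid n) → Coloopless M → IsCyclic M (∁ ⊥)
coloopless⇒cyclic-∁⊥ M coloopless e _ = begin
  rank M (∁ ⊥)        ≤⟨ rank-mono M (λ _ → ∈⊤) ⟩
  rank M ⊤            ≡⟨ sym (coloopless e) ⟩
  rank M (∁ ⁅ e ⁆)    ≤⟨ rank-mono M (λ x∈∁e → x∈p∧x∉q⇒x∈p─q (x∉p⇒x∈∁p ∉⊥) (x∈∁p⇒x∉p x∈∁e)) ⟩
  rank M (∁ ⊥ - e)    ∎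
  where open ≤-Reasoning

-- The part of being a biflat F|G that survives at the end terms ∅|E and E|∅.
IsWeakBiflat : Matroid n → Subset n → Subset n → Set
IsWeakBiflat M F G = IsFlat M F × IsCyclic M (∁ G) × F ∪ G ≡ ⊤

biflat⇒weakBiflat : ∀ (M : Matroid n) {F G} → IsBiflat M F G → IsWeakBiflat M F G
biflat⇒weakBiflat M (flat , dualFlat , _ , _ , _ , cover) =
  flat , dualFlat⇒cyclic-∁ M dualFlat , cover

ext-pointwise : ∀ {k} (P : Subset n → Subset n → Set) {s t : Fin k → Subset n} {a b c d}
  → P a b → P c d → (∀ i → P (s i) (t i)) → ∀ m → P (ext s a c m) (ext t b d m)
ext-pointwise P Pab Pcd Pst zero = Pab
ext-pointwise {k = k} P Pab Pcd Pst (suc m) with m <? k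
... | yes m<k = Pst (fromℕ< m<k)
... | no _    = Pcd

ext-weakBiflat : ∀ (M : Matroid n) → Loopless M → Coloopless M → ∀ {k} {F G : Fin k → Subset n}
  → IsBiflag M k F G → ∀ m → IsWeakBiflat M (Fext F m) (Gext G m)
ext-weakBiflat M loopless coloopless biflag = ext-pointwise (IsWeakBiflat M)
  (loopless⇒flat-⊥ M loopless , cyclic-∁⊤ M , ∪-identityˡ ⊤)
  (flat-⊤ (rank M) , coloopless⇒cyclic-∁⊥ M coloopless , ∪-identityʳ ⊤)
  (λ i → biflat⇒weakBiflat M (IsBiflag.biflat biflag i))

weakBiflat-gap≢⁅e⁆ : ∀ (M : Matroid n) {F G F′ G′ e}
  → IsWeakBiflat M F G → IsWeakBiflat M F′ G′
  → e ∈ (F′ ─ F) ∩ (G ─ G′) → ¬ ((F′ ─ F) ∩ (G ─ G′) ⊆ ⁅ e ⁆)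
weakBiflat-gap≢⁅e⁆ M {F} {G} {F′} {G′} {e} (flat , _ , cover) (_ , cyclic , cover′) e∈gap gap⊆⁅e⁆ =
  <⇒≱ (flat e e∉F) (≤-trans (rank-mono M F∪e⊆F∪A) (rank∩≥⇒rank∪≤ M rA≤rF∩A))
  where
  A = ∁ G′
  e∉F = x∈p─q⇒x∉q F′ F (proj₁ (x∈p∩q⁻ _ _ e∈gap))
  e∈A = x∉p⇒x∈∁p (x∈p─q⇒x∉q G G′ (proj₂ (x∈p∩q⁻ _ _ e∈gap)))

  A-e⊆F : A - e ⊆ F
  A-e⊆F {x} x∈A-e with ∪≡⊤⇒∈⊎∈ cover x | ∪≡⊤⇒∈⊎∈ cover′ x
  ... | inj₁ x∈F | _          = x∈F
  ... | inj₂ _   | inj₂ x∈G′  = contradiction x∈G′ (x∈∁p⇒x∉p (p─q⊆p A _ x∈A-e))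
  ... | inj₂ x∈G | inj₁ x∈F′  with x ∈? F
  ...   | yes x∈F = x∈F
  ...   | no x∉F  = contradiction
    (gap⊆⁅e⁆ (x∈p∩q⁺ (x∈p∧x∉q⇒x∈p─q x∈F′ x∉F , x∈p∧x∉q⇒x∈p─q x∈G (x∈∁p⇒x∉p (p─q⊆p A _ x∈A-e)))))
    (x∈p─q⇒x∉q A ⁅ e ⁆ x∈A-e)

  rA≤rF∩A : rank M A ≤ rank M (F ∩ A)
  rA≤rF∩A = ≤-trans (cyclic e e∈A) (rank-mono M λ x∈ → x∈p∩q⁺ (A-e⊆F x∈ , p─q⊆p A _ x∈))

  F∪e⊆F∪A : F ∪ ⁅ e ⁆ ⊆ F ∪ A
  F∪e⊆F∪A x∈ with x∈p∪q⁻ F ⁅ e ⁆ x∈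
  ... | inj₁ x∈F  = p⊆p∪q A x∈F
  ... | inj₂ x∈⁅e⁆ rewrite x∈⁅y⁆⇒x≡y e x∈⁅e⁆ = q⊆p∪q F A e∈A

proposition3p14 : ∀ {n} (M : Matroid n) → Loopless M → Coloopless M
    → (k : ℕ) (F G : Fin k → Subset n) → IsBiflag M k F G
    → (j : Fin (suc k)) → Nonempty (gap F G j)
    → ∃₂ λ a b → a ≢ b × a ∈ gap F G j × b ∈ gap F G j
proposition3p14 M loopless coloopless k F G biflag j (e , e∈gap)
  with ⊆⁅x⁆⊎∃≢x (gap F G j) e∈gap
... | inj₂ (b , b≢e , b∈gap) = e , b , (λ e≡b → b≢e (sym e≡b)) , e∈gap , b∈gap
... | inj₁ gap⊆⁅e⁆ = ⊥-elim
  (weakBiflat-gap≢⁅e⁆ M (weakBiflat (toℕ j)) (weakBiflat (suc (toℕ j))) e∈gap gap⊆⁅e⁆)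
  where
  weakBiflat = ext-weakBiflat M loopless coloopless biflag
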